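{- For every finite simple graph $G$, $$\sum_{v\in V(G)}\frac{1}{\zeta(v)+1}\geq \sum_{v\in V(G)} \frac{1}{\deg_G(v)+1},$$ and equality holds if and only if each connected component of $G$ is regular.
   Context: For a vertex $v$, $\zeta(v)=\max_H \delta(H)$, the maximum over all subgraphs $H$ of $G$ containing $v$, where $\delta(H)$ is the minimum degree of $H$. -}

module Defs where

open import Data.Nat using (ℕ; zero; suc; _≤_)
open import Data.Fin using (Fin; zero; suc)
open import Data.Bool using (Bool; true; false; if_then_else_)
open import Data.Product using (Σ; ∃; _×_)
open import Data.Integer using (+_)
open import Data.Rational as ℚ using (ℚ; _/_)
open import Relation.Binary.PropositionalEquality using (_≡_)
open import Relation.Binary.Construct.Closure.ReflexiveTransitive using (Star)

record Graph : Set where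
  field
    n      : ℕ
    adj    : Fin n → Fin n → Bool
    sym    : ∀ u w → adj u w ≡ adj w u
    irrefl : ∀ u → adj u u ≡ false
open Graph public

sumℕ : ∀ {n} → (Fin n → ℕ) → ℕ
sumℕ {zero}  f = 0
sumℕ {suc n} f = f zero Data.Nat.+ sumℕ (λ i → f (suc i))

sumℚ : ∀ {n} → (Fin n → ℚ) → ℚ
sumℚ {zero}  f = ℚ.0ℚ
sumℚ {suc n} f = f zero ℚ.+ sumℚ (λ i → f (suc i))

degIn : ∀ {n} → (Fin n → Fin n → Bool) → Fin n → ℕ
degIn es u = sumℕ (λ w → if es u w then 1 else 0)

deg : (G : Graph) → Fin (n G) → ℕ
deg G = degIn (adj G)

record Subgraph (G : Graph) : Set where
  field
    vs     : Fin (n G) → Bool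
    es     : Fin (n G) → Fin (n G) → Bool
    es-sym : ∀ u w → es u w ≡ es w u
    es-sub : ∀ u w → es u w ≡ true → adj G u w ≡ true
    es-vs  : ∀ u w → es u w ≡ true → vs u ≡ true
open Subgraph public

degH : {G : Graph} → Subgraph G → Fin (n G) → ℕ
degH H = degIn (es H)

IsMinDeg : {G : Graph} → Subgraph G → ℕ → Set
IsMinDeg {G} H d =
  (Σ (Fin (n G)) λ u → vs H u ≡ true × degH H u ≡ d)
  × (∀ u → vs H u ≡ true → d ≤ degH H u)

-- k = ζ(v) = max { δ(H) : H subgraph of G containing v }
IsZeta : (G : Graph) → Fin (n G) → ℕ → Set
IsZeta G v k =
  (Σ (Subgraph G) λ H → vs H v ≡ true × IsMinDeg H k)
  × (∀ (H : Subgraph G) d → vs H v ≡ true → IsMinDeg H d → d ≤ k)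

Connected : (G : Graph) → Fin (n G) → Fin (n G) → Set
Connected G = Star (λ u w → adj G u w ≡ true)

ComponentsRegular : Graph → Set
ComponentsRegular G = ∀ u w → Connected G u w → deg G u ≡ deg G w

inv1+ : ℕ → ℚ
inv1+ k = (+ 1) / suc k

-- A subgraph H containing v has δ(H) ≤ deg_H(v) ≤ deg_G(v), so ζ(v) ≤ deg(v) and the
-- inequality holds termwise. If the sums agree, then ζ(v) = deg(v) for every v: a
-- witness H for ζ(w) = deg(w) must keep every edge at w, so each neighbour u of w lies
-- in H and deg(w) ≤ deg_H(u) ≤ deg(u); by symmetry adjacent vertices have equal degree.
-- Conversely, if every component is d-regular, the vertices of degree d = deg(v)
-- together with all their edges form a subgraph of minimum degree d containing v.
module Submission where

open import Defs
open import Data.Nat using (ℕ)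
open import Data.Fin using (Fin)
open import Data.Product using (_×_)
open import Data.Rational using (_≤_)
open import Relation.Binary.PropositionalEquality using (_≡_)
open import Function.Bundles using (_⇔_)

open import Data.Bool using (Bool; true; false; if_then_else_; _∧_)
open import Data.Bool.Properties using (T-≡; ∧-identityʳ)
open import Data.Empty using (⊥-elim)
open import Data.Fin using (zero; suc)
open import Data.Integer as ℤ using (+_)
import Data.Integer.Properties as ℤ
open import Data.Nat as ℕ using (zero; suc; _≡ᵇ_)
import Data.Nat.Properties as ℕ
open import Data.Nat.Coprimality using (1-coprimeTo)
open import Data.Product using (Σ; _,_)
open import Data.Sum using (inj₁; inj₂)
open import Data.Rational as ℚ using (ℚ; mkℚ; _<_)
import Data.Rational.Properties as ℚ
open import Function using (_∘_)
open import Function.Bundles using (mk⇔; Equivalence)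
open import Relation.Binary.Construct.Closure.ReflexiveTransitive using (ε; _◅_)
open import Relation.Binary.Definitions using (tri<; tri≈; tri>)
open import Relation.Binary.PropositionalEquality as ≡
  using (refl; trans; cong; cong₂; subst; subst₂)

sumℕ-mono-≤ : ∀ {m} {f g : Fin m → ℕ} → (∀ i → f i ℕ.≤ g i) → sumℕ f ℕ.≤ sumℕ g
sumℕ-mono-≤ {zero}  f≤g = ℕ.z≤n
sumℕ-mono-≤ {suc m} f≤g = ℕ.+-mono-≤ (f≤g zero) (sumℕ-mono-≤ (f≤g ∘ suc))

sumℕ-mono-< : ∀ {m} {f g : Fin m → ℕ} → (∀ i → f i ℕ.≤ g i) →
              ∀ j → f j ℕ.< g j → sumℕ f ℕ.< sumℕ g
sumℕ-mono-< f≤g zero    fj<gj = ℕ.+-mono-<-≤ fj<gj (sumℕ-mono-≤ (f≤g ∘ suc))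
sumℕ-mono-< f≤g (suc j) fj<gj = ℕ.+-mono-≤-< (f≤g zero) (sumℕ-mono-< (f≤g ∘ suc) j fj<gj)

sumℕ-tight : ∀ {m} {f g : Fin m → ℕ} → (∀ i → f i ℕ.≤ g i) → sumℕ g ℕ.≤ sumℕ f →
             ∀ i → f i ≡ g i
sumℕ-tight f≤g Σg≤Σf i with ℕ.m≤n⇒m<n∨m≡n (f≤g i)
... | inj₂ fi≡gi = fi≡gi
... | inj₁ fi<gi = ⊥-elim (ℕ.<⇒≱ (sumℕ-mono-< f≤g i fi<gi) Σg≤Σf)

sumℚ-mono-≤ : ∀ {m} {f g : Fin m → ℚ} → (∀ i → f i ≤ g i) → sumℚ f ≤ sumℚ g
sumℚ-mono-≤ {zero}  f≤g = ℚ.≤-refl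
sumℚ-mono-≤ {suc m} f≤g = ℚ.+-mono-≤ (f≤g zero) (sumℚ-mono-≤ (f≤g ∘ suc))

sumℚ-mono-< : ∀ {m} {f g : Fin m → ℚ} → (∀ i → f i ≤ g i) →
              ∀ j → f j < g j → sumℚ f < sumℚ g
sumℚ-mono-< f≤g zero    fj<gj = ℚ.+-mono-<-≤ fj<gj (sumℚ-mono-≤ (f≤g ∘ suc))
sumℚ-mono-< f≤g (suc j) fj<gj = ℚ.+-mono-≤-< (f≤g zero) (sumℚ-mono-< (f≤g ∘ suc) j fj<gj)

sumℚ-tight : ∀ {m} {f g : Fin m → ℚ} → (∀ i → f i ≤ g i) → sumℚ g ≤ sumℚ f →
             ∀ i → f i ≡ g i
sumℚ-tight f≤g Σg≤Σf i = ℚ.≤-antisym (f≤g i) (ℚ.≮⇒≥ (λ fi<gi →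
  ℚ.<-irrefl refl (ℚ.<-≤-trans (sumℚ-mono-< f≤g i fi<gi) Σg≤Σf)))

sumℚ-cong : ∀ {m} {f g : Fin m → ℚ} → (∀ i → f i ≡ g i) → sumℚ f ≡ sumℚ g
sumℚ-cong {zero}  f≡g = refl
sumℚ-cong {suc m} f≡g = cong₂ ℚ._+_ (f≡g zero) (sumℚ-cong (f≡g ∘ suc))

inv1+≡mkℚ : ∀ k → inv1+ k ≡ mkℚ (+ 1) k (1-coprimeTo (suc k))
inv1+≡mkℚ k = ℚ.normalize-coprime (1-coprimeTo (suc k))

-- The cross-multiplied numerators are 1 * (1 + k), which is not definitionally 1 + k.
inv1+-antimono-≤ : ∀ {a b} → a ℕ.≤ b → inv1+ b ≤ inv1+ a
inv1+-antimono-≤ {a} {b} a≤b rewrite inv1+≡mkℚ a | inv1+≡mkℚ b =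
  ℚ.*≤* (subst₂ ℤ._≤_ (≡.sym (ℤ.*-identityˡ (+ suc a))) (≡.sym (ℤ.*-identityˡ (+ suc b)))
           (ℤ.+≤+ (ℕ.s≤s a≤b)))

inv1+-antimono-< : ∀ {a b} → a ℕ.< b → inv1+ b < inv1+ a
inv1+-antimono-< {a} {b} a<b rewrite inv1+≡mkℚ a | inv1+≡mkℚ b =
  ℚ.*<* (subst₂ ℤ._<_ (≡.sym (ℤ.*-identityˡ (+ suc a))) (≡.sym (ℤ.*-identityˡ (+ suc b)))
           (ℤ.+<+ (ℕ.s≤s a<b)))

inv1+-injective : ∀ {a b} → inv1+ a ≡ inv1+ b → a ≡ b
inv1+-injective {a} {b} eq with ℕ.<-cmp a b
... | tri< a<b _ _ = ⊥-elim (ℚ.<-irrefl (≡.sym eq) (inv1+-antimono-< a<b))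
... | tri≈ _ a≡b _ = a≡b
... | tri> _ _ b<a = ⊥-elim (ℚ.<-irrefl eq (inv1+-antimono-< b<a))

sumℕ-cong : ∀ {m} {f g : Fin m → ℕ} → (∀ i → f i ≡ g i) → sumℕ f ≡ sumℕ g
sumℕ-cong {zero}  f≡g = refl
sumℕ-cong {suc m} f≡g = cong₂ ℕ._+_ (f≡g zero) (sumℕ-cong (f≡g ∘ suc))

∧≡true⇒ˡ : ∀ {a b} → a ∧ b ≡ true → a ≡ true
∧≡true⇒ˡ {true} _ = refl

∧≡true⇒ʳ : ∀ {a b} → a ∧ b ≡ true → b ≡ true
∧≡true⇒ʳ {true} b≡true = b≡true

indicator : Bool → ℕ
indicator b = if b then 1 else 0

indicator-mono : ∀ {b c} → (b ≡ true → c ≡ true) → indicator b ℕ.≤ indicator c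
indicator-mono {false} b⇒c = ℕ.z≤n
indicator-mono {true}  b⇒c rewrite b⇒c refl = ℕ.≤-refl

indicator≡1⇒true : ∀ {b} → indicator b ≡ 1 → b ≡ true
indicator≡1⇒true {true} _ = refl

module _ {G : Graph} where

  adj-sym : ∀ {u w} → adj G u w ≡ true → adj G w u ≡ true
  adj-sym {u} {w} e = trans (Graph.sym G w u) e

  degH≤deg : (H : Subgraph G) → ∀ u → degH H u ℕ.≤ deg G u
  degH≤deg H u = sumℕ-mono-≤ (λ w → indicator-mono (es-sub H u w))

  deg≤degH⇒adj⊆es : (H : Subgraph G) → ∀ {u w} → deg G u ℕ.≤ degH H u →
                    adj G u w ≡ true → es H u w ≡ true
  deg≤degH⇒adj⊆es H {u} {w} full e = indicator≡1⇒true (begin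
      indicator (es H u w)   ≡⟨ sumℕ-tight (λ x → indicator-mono (es-sub H u x)) full w ⟩
      indicator (adj G u w)  ≡⟨ cong indicator e ⟩
      1                      ∎)
    where open ≡.≡-Reasoning

  zeta≤deg : ∀ {v k} → IsZeta G v k → k ℕ.≤ deg G v
  zeta≤deg {v} ((H , v∈H , _ , δ≤degH) , _) = ℕ.≤-trans (δ≤degH v v∈H) (degH≤deg H v)

  minDeg≡deg⇒deg≤neighbour : (H : Subgraph G) → ∀ {w u} → vs H w ≡ true →
                              IsMinDeg H (deg G w) → adj G w u ≡ true → deg G w ℕ.≤ deg G u
  minDeg≡deg⇒deg≤neighbour H {w} {u} w∈H (_ , δ≤degH) e =
    ℕ.≤-trans (δ≤degH u u∈H) (degH≤deg H u)
    where
      wu∈H : es H w u ≡ true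
      wu∈H = deg≤degH⇒adj⊆es H (δ≤degH w w∈H) e
      u∈H : vs H u ≡ true
      u∈H = es-vs H u w (trans (es-sym H u w) wu∈H)

  zeta≡deg⇒regular : (∀ v → IsZeta G v (deg G v)) → ComponentsRegular G
  zeta≡deg⇒regular isZ u .u ε        = refl
  zeta≡deg⇒regular isZ u w  (e ◅ uw) =
    trans (ℕ.≤-antisym (deg≤neighbour e) (deg≤neighbour (adj-sym e))) (zeta≡deg⇒regular isZ _ w uw)
    where
      deg≤neighbour : ∀ {x y} → adj G x y ≡ true → deg G x ℕ.≤ deg G y
      deg≤neighbour {x} e with isZ x
      ... | (H , x∈H , minDeg) , _ = minDeg≡deg⇒deg≤neighbour H x∈H minDeg e

  hasDeg : ℕ → Fin (n G) → Bool
  hasDeg d u = deg G u ≡ᵇ d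

  hasDeg⇒≡ : ∀ {d u} → hasDeg d u ≡ true → deg G u ≡ d
  hasDeg⇒≡ {d} {u} h = ℕ.≡ᵇ⇒≡ (deg G u) d (Equivalence.from T-≡ h)

  hasDeg-deg : ∀ u → hasDeg (deg G u) u ≡ true
  hasDeg-deg u = Equivalence.to T-≡ (ℕ.≡⇒≡ᵇ (deg G u) (deg G u) refl)

  module _ (reg : ComponentsRegular G) (d : ℕ) where

    edgesAtDeg : Fin (n G) → Fin (n G) → Bool
    edgesAtDeg u w = adj G u w ∧ hasDeg d u

    -- Symmetric because adjacent vertices have the same degree.
    edgesAtDeg-sym : ∀ u w → edgesAtDeg u w ≡ edgesAtDeg w u
    edgesAtDeg-sym u w with adj G u w in e
    ... | false rewrite Graph.sym G w u | e = refl
    ... | true  rewrite Graph.sym G w u | e | reg u w (e ◅ ε) = refl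

    degreeClass : Subgraph G
    degreeClass = record
      { vs     = hasDeg d
      ; es     = edgesAtDeg
      ; es-sym = edgesAtDeg-sym
      ; es-sub = λ _ _ → ∧≡true⇒ˡ
      ; es-vs  = λ _ _ → ∧≡true⇒ʳ
      }

    degH-degreeClass : ∀ {u} → hasDeg d u ≡ true → degH degreeClass u ≡ deg G u
    degH-degreeClass {u} u∈H = sumℕ-cong λ w → cong indicator (begin
        adj G u w ∧ hasDeg d u  ≡⟨ cong (adj G u w ∧_) u∈H ⟩
        adj G u w ∧ true        ≡⟨ ∧-identityʳ (adj G u w) ⟩
        adj G u w               ∎)
      where open ≡.≡-Reasoning

  regular⇒deg≤zeta : ComponentsRegular G → ∀ {v k} → IsZeta G v k → deg G v ℕ.≤ k
  regular⇒deg≤zeta reg {v} (_ , δ≤ζ) = δ≤ζ H d (hasDeg-deg v) (witness , δ≤degH)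
    where
      d = deg G v
      H = degreeClass reg d
      witness : Σ (Fin (n G)) λ u → vs H u ≡ true × degH H u ≡ d
      witness = v , hasDeg-deg v , degH-degreeClass reg d (hasDeg-deg v)
      δ≤degH : ∀ u → vs H u ≡ true → d ℕ.≤ degH H u
      δ≤degH u u∈H = ℕ.≤-reflexive (≡.sym (trans (degH-degreeClass reg d u∈H) (hasDeg⇒≡ u∈H)))

proposition3 : (G : Graph) (ζ : Fin (n G) → ℕ) → (∀ v → IsZeta G v (ζ v))
    → (sumℚ (λ v → inv1+ (deg G v)) ≤ sumℚ (λ v → inv1+ (ζ v)))
      × ((sumℚ (λ v → inv1+ (ζ v)) ≡ sumℚ (λ v → inv1+ (deg G v))) ⇔ ComponentsRegular G)
proposition3 G ζ isZ = sumℚ-mono-≤ inv-deg≤inv-ζ , mk⇔ equal⇒regular regular⇒equal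
  where
    ζ≤deg : ∀ v → ζ v ℕ.≤ deg G v
    ζ≤deg v = zeta≤deg (isZ v)

    inv-deg≤inv-ζ : ∀ v → inv1+ (deg G v) ≤ inv1+ (ζ v)
    inv-deg≤inv-ζ = inv1+-antimono-≤ ∘ ζ≤deg

    equal⇒regular : sumℚ (λ v → inv1+ (ζ v)) ≡ sumℚ (λ v → inv1+ (deg G v)) → ComponentsRegular G
    equal⇒regular Σζ≡Σdeg = zeta≡deg⇒regular λ v → subst (IsZeta G v) (ζ≡deg v) (isZ v)
      where
        ζ≡deg : ∀ v → ζ v ≡ deg G v
        ζ≡deg v = ≡.sym (inv1+-injective (sumℚ-tight inv-deg≤inv-ζ (ℚ.≤-reflexive Σζ≡Σdeg) v))

    regular⇒equal : ComponentsRegular G → sumℚ (λ v → inv1+ (ζ v)) ≡ sumℚ (λ v → inv1+ (deg G v))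
    regular⇒equal reg = sumℚ-cong λ v →
      cong inv1+ (ℕ.≤-antisym (ζ≤deg v) (regular⇒deg≤zeta reg (isZ v)))
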